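{- There exist a polynomial $p$ and a family $(P_n)_{n\in\mathbb{N}}$ of POMDPs, where $P_n$ has size $O(p(n))$ and is equipped with a safety objective, such that: (a) Player 1 has a pure observation-based almost-sure (and therefore also positive) winning strategy in each $P_n$; and (b) there exists a polynomial $q$ such that every finite-memory randomized observation-based strategy for Player 1 that is positive (or almost-sure) winning in $P_n$ has at least $2^{q(n)}$ memory states.
   Context: A POMDP is a tuple $G=\langle L,\Sigma,\delta,\mathcal{O}\rangle$ where $L$ is a finite set of states, $\Sigma$ a finite set of actions, $\delta: L\times\Sigma\to\mathcal{D}(L)$ a probabilistic transition function, and $\mathcal{O}\subseteq 2^L$ a set of observations partitioning $L$, together with an initial state. A play is an infinite sequence $\ell_0\sigma_0\ell_1\ldots$ with $\delta(\ell_i,\sigma_i)(\ell_{i+1})>0$. A safety objective $\mathsf{Safe}(\mathcal{T})$, $\mathcal{T}\subseteq L$, is the set of plays staying in $\mathcal{T}$. An observation-based strategy with memory set $\mathrm{Mem}$ is given by a memory-update function $\mathrm{Mem}\times\mathcal{O}\times\Sigma\to\mathrm{Mem}$ and a next-action function $\mathrm{Mem}\times\mathcal{O}\to\mathcal{D}(\Sigma)$ (for pure strategies, $\to\Sigma$); it is finite-memory if $\mathrm{Mem}$ is finite, and its number of (memory) states is $|\mathrm{Mem}|$. A strategy $\alpha$ is almost-sure (resp. positive) winning for $\varphi$ from the initial state $\ell$ if $\Pr^\alpha_\ell(\varphi)=1$ (resp. $>0$).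
   Formalization: In part (b), the lower bound covers only finite-memory randomized observation-based strategies whose action distributions take rational values. -}

module Defs where

open import Data.Nat as ℕ using (ℕ; zero; suc; _≤_; _<_; _^_)
open import Data.Fin using (Fin; zero; suc)
open import Data.Bool using (Bool; true; false; if_then_else_)
open import Data.List using (List; []; _∷_)
open import Data.List.Relation.Unary.Any using (Any)
open import Data.Integer using (∣_∣)
open import Data.Rational as ℚ using (ℚ; 0ℚ; 1ℚ)
open import Data.Product using (Σ; Σ-syntax; _×_; _,_)
open import Relation.Binary.PropositionalEquality using (_≡_)

sumℕ : (n : ℕ) → (Fin n → ℕ) → ℕ
sumℕ zero    f = 0
sumℕ (suc n) f = f zero ℕ.+ sumℕ n (λ i → f (suc i))

sumℚ : (n : ℕ) → (Fin n → ℚ) → ℚ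
sumℚ zero    f = 0ℚ
sumℚ (suc n) f = f zero ℚ.+ sumℚ n (λ i → f (suc i))

-- Polynomials with natural-number coefficients (coefficient lists,
-- constant coefficient first)

Poly : Set
Poly = List ℕ

eval : Poly → ℕ → ℕ
eval []       x = 0
eval (c ∷ cs) x = c ℕ.+ x ℕ.* eval cs x

NonConstant : Poly → Set
NonConstant []       = Data.Bool.T false
  where import Data.Bool
NonConstant (c ∷ cs) = Any (λ a → 0 < a) cs

BigO : (ℕ → ℕ) → Poly → Set
BigO f p = Σ[ c ∈ ℕ ] Σ[ N ∈ ℕ ] (∀ n → N ≤ n → f n ≤ c ℕ.* eval p n)

record POMDP : Set where
  field
    nL nΣ nO : ℕ
    δ        : Fin nL → Fin nΣ → Fin nL → ℚ
    δ-nonneg : ∀ l a l' → 0ℚ ℚ.≤ δ l a l'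
    δ-sum    : ∀ l a → sumℚ nL (δ l a) ≡ 1ℚ
    obs      : Fin nL → Fin nO           -- observation (partition block) of a state
    obs-surj : ∀ o → Σ[ l ∈ Fin nL ] obs l ≡ o   -- blocks are nonempty
    init     : Fin nL

open POMDP public

size : POMDP → ℕ
size G = nL G ℕ.+ nΣ G ℕ.+ nO G ℕ.+
  sumℕ (nL G) (λ l → sumℕ (nΣ G) (λ a → sumℕ (nL G) (λ l' →
    ∣ ℚ.numerator (δ G l a l') ∣ ℕ.+ ℚ.denominatorℕ (δ G l a l'))))

Target : POMDP → Set
Target G = Fin (nL G) → Bool

record Strategy (G : POMDP) (Mem : Set) : Set where
  field
    m₀       : Mem
    upd      : Mem → Fin (nO G) → Fin (nΣ G) → Mem
    nxt      : Mem → Fin (nO G) → Fin (nΣ G) → ℚ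
    nxt-nonneg : ∀ m o a → 0ℚ ℚ.≤ nxt m o a
    nxt-sum    : ∀ m o → sumℚ (nΣ G) (nxt m o) ≡ 1ℚ

record PureStrategy (G : POMDP) (Mem : Set) : Set where
  field
    m₀  : Mem
    upd : Mem → Fin (nO G) → Fin (nΣ G) → Mem
    act : Mem → Fin (nO G) → Fin (nΣ G)

dirac : {n : ℕ} → Fin n → Fin n → ℚ
dirac zero    zero    = 1ℚ
dirac zero    (suc _) = 0ℚ
dirac (suc _) zero    = 0ℚ
dirac (suc i) (suc j) = dirac i j

-- From current state l and memory m: an action a is drawn
-- from the action distribution at (m , obs l), the next state l' is drawn
-- from δ l a, and the memory becomes upd m (obs l) a.
-- safeProb G T upd nxt k l m  =  probability that the states
-- l₀ = l, l₁, …, l_k all lie in T.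

safeProb : (G : POMDP) → Target G → {Mem : Set} →
           (Mem → Fin (nO G) → Fin (nΣ G) → Mem) →
           (Mem → Fin (nO G) → Fin (nΣ G) → ℚ) →
           ℕ → Fin (nL G) → Mem → ℚ
safeProb G T upd nxt k l m with T l
... | false = 0ℚ
safeProb G T upd nxt zero    l m | true = 1ℚ
safeProb G T upd nxt (suc k) l m | true =
  sumℚ (nΣ G) (λ a → nxt m (obs G l) a ℚ.*
    sumℚ (nL G) (λ l' → δ G l a l' ℚ.*
      safeProb G T upd nxt k l' (upd m (obs G l) a)))

-- Pr(Safe(T)) is the infimum (limit) of the decreasing sequence
-- safeProb … k (init) m₀.
AlmostSure : (G : POMDP) → Target G → {Mem : Set} → Strategy G Mem → Set
AlmostSure G T σ = ∀ k → safeProb G T (Strategy.upd σ) (Strategy.nxt σ) k (init G) (Strategy.m₀ σ) ≡ 1ℚ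

Positive : (G : POMDP) → Target G → {Mem : Set} → Strategy G Mem → Set
Positive G T σ = Σ[ ε ∈ ℚ ] (0ℚ ℚ.< ε ×
  (∀ k → ε ℚ.≤ safeProb G T (Strategy.upd σ) (Strategy.nxt σ) k (init G) (Strategy.m₀ σ)))

AlmostSurePure : (G : POMDP) → Target G → {Mem : Set} → PureStrategy G Mem → Set
AlmostSurePure G T σ = ∀ k →
  safeProb G T (PureStrategy.upd σ) (λ m o → dirac (PureStrategy.act σ m o)) k (init G) (PureStrategy.m₀ σ) ≡ 1ℚ

-- Each round of the gadget P n shows n + 1 random bits one at a time, while coin flips hidden in
-- the state select one position and store its bit; afterwards the positions are shown again
-- without their bits, and answering the wrong bit at the selected position leads to a losing
-- sink. Storing all the bits wins almost surely. Conversely, fix for every memory state and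
-- observation an action of positive probability. If from some memory state a whole round is
-- survived with probability 1, then along these actions the memory at the end of the reveal
-- phase, which cannot depend on the selected position, determines every bit, so there are at
-- least 2 ^ (n + 1) memory states. Otherwise, there being finitely many memory states, every
-- round is lost with probability at least 1 - B for one B < 1, so r rounds are survived with
-- probability at most B ^ r, which tends to 0: the strategy is not even positively winning.

module Submission where

open import Defs

open import Data.Bool using (Bool; true; false; _∧_; not; if_then_else_)
open import Data.Bool.Properties using (¬-not; not-¬)
open import Data.Empty using (⊥; ⊥-elim; ⊥-elim-irr)
open import Data.Fin as Fin using (Fin; zero; suc; toℕ)
open import Data.Fin.Patterns using (0F; 1F; 2F; 3F)
open import Data.Fin.Properties as FinP using (all?; *↔×)
open import Data.Integer as ℤ using (+<+)
open import Data.List using (_∷_; [])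
open import Data.Maybe using (Maybe; just; nothing)
open import Data.Nat as ℕ using (ℕ; zero; suc; z≤n; s≤s)
import Data.Nat.Properties as ℕP
import Data.Nat.Tactic.RingSolver as ℕSolver
open import Data.Product using (Σ; Σ-syntax; ∃; ∃₂; _×_; _,_; proj₁; proj₂)
open import Data.Product.Function.NonDependent.Propositional using (_×-↔_)
open import Data.Rational as ℚ using (ℚ; 0ℚ; 1ℚ; ½; _+_; _*_)
import Data.Rational.Properties as ℚP
open import Data.Sum using (_⊎_; inj₁; inj₂)
open import Data.Unit using (⊤; tt)
open import Data.Vec.Functional using (updateAt)
open import Data.Vec.Functional.Properties using (updateAt-updates; updateAt-minimal)
open import Function using (_∘_; _$_; const)
open import Function.Bundles using (_↔_; mk↔ₛ′; Inverse)
open import Function.Properties.Inverse using (↔-refl; ↔-sym; ↔-trans)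
open import Relation.Binary using (tri<; tri≈; tri>)
open import Relation.Binary.PropositionalEquality
open import Relation.Nullary using (¬_; yes; no; does)
open import Relation.Nullary.Decidable using (toWitness)

module RationalFacts where
  import Data.Integer.Properties as ℤP
  open import Data.Integer.Tactic.RingSolver using (solve-∀)
  open import Data.Rational using (_≤_; _<_)
  open import Data.Rational.Unnormalised as ℚᵘ using (mkℚᵘ; _≃_)
  import Data.Rational.Unnormalised.Properties as ℚᵘP
  open import Algebra.Definitions.RawMonoid ℚᵘ.+-0-rawMonoid using () renaming (_×_ to _·ᵘ_)
  open import Algebra.Definitions.RawSemiring ℚ.+-*-rawSemiring using (_^_) renaming (_×_ to _·_)

  0<1 : 0ℚ < 1ℚ
  0<1 = ℚ.*<* (+<+ (s≤s z≤n))

  ≤∧≢⇒< : ∀ {p q} → p ≤ q → p ≢ q → p < q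
  ≤∧≢⇒< {p} {q} p≤q p≢q with ℚP.<-cmp p q
  ... | tri< p<q _ _ = p<q
  ... | tri≈ _ p≡q _ = ⊥-elim (p≢q p≡q)
  ... | tri> _ _ p>q = ⊥-elim (ℚP.<-irrefl refl (ℚP.<-≤-trans p>q p≤q))

  *-nonNeg : ∀ {p q} → 0ℚ ≤ p → 0ℚ ≤ q → 0ℚ ≤ p * q
  *-nonNeg {p} {q} 0≤p 0≤q =
    subst (_≤ p * q) (ℚP.*-zeroʳ p) (ℚP.*-monoˡ-≤-nonNeg p {{ℚ.nonNegative 0≤p}} 0≤q)

  *-monoˡ-≤-onPos : ∀ {c p q} → 0ℚ ≤ c → (0ℚ < c → p ≤ q) → c * p ≤ c * q
  *-monoˡ-≤-onPos {c} {p} {q} 0≤c p≤q with c ℚP.≟ 0ℚ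
  ... | yes refl = ℚP.≤-reflexive (trans (ℚP.*-zeroˡ p) (sym (ℚP.*-zeroˡ q)))
  ... | no c≢0 = ℚP.*-monoˡ-≤-nonNeg c {{ℚ.nonNegative 0≤c}} (p≤q (≤∧≢⇒< 0≤c (c≢0 ∘ sym)))

  commonBound<1 : ∀ m (f : Fin m → ℚ) → (∀ i → f i < 1ℚ) →
                  Σ[ B ∈ ℚ ] 0ℚ ≤ B × B < 1ℚ × (∀ i → f i ≤ B)
  commonBound<1 zero    f f<1 = 0ℚ , ℚP.≤-refl , 0<1 , λ ()
  commonBound<1 (suc m) f f<1 =
    let B , 0≤B , B<1 , f≤B = commonBound<1 m (f ∘ suc) (f<1 ∘ suc) in
    f zero ℚ.⊔ B , ℚP.p≤q⇒p≤r⊔q (f zero) 0≤B , max<1 B<1 (ℚP.⊔-sel (f zero) B) ,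
    λ { zero → ℚP.p≤p⊔q (f zero) B ; (suc i) → ℚP.p≤q⇒p≤r⊔q (f zero) (f≤B i) }
    where
    max<1 : ∀ {B} → B < 1ℚ → (f zero ℚ.⊔ B ≡ f zero) ⊎ (f zero ℚ.⊔ B ≡ B) → f zero ℚ.⊔ B < 1ℚ
    max<1 B<1 (inj₁ ≡f₀) = subst (_< 1ℚ) (sym ≡f₀) (f<1 zero)
    max<1 B<1 (inj₂ ≡B)  = subst (_< 1ℚ) (sym ≡B) B<1

  toℚᵘ-· : ∀ r y → ℚ.toℚᵘ (r · y) ≃ r ·ᵘ ℚ.toℚᵘ y
  toℚᵘ-· zero    y = ℚᵘP.≃-refl
  toℚᵘ-· (suc r) y = ℚᵘP.≃-trans (ℚP.toℚᵘ-homo-+ y (r · y)) (ℚᵘP.+-congʳ (ℚ.toℚᵘ y) (toℚᵘ-· r y))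

  ·ᵘ-mkℚᵘ : ∀ r a d → r ·ᵘ mkℚᵘ a d ≃ mkℚᵘ (ℤ.+ r ℤ.* a) d
  ·ᵘ-mkℚᵘ zero    a d = ℚᵘ.*≡* refl
  ·ᵘ-mkℚᵘ (suc r) a d = ℚᵘP.≃-trans (ℚᵘP.+-congʳ (mkℚᵘ a d) (·ᵘ-mkℚᵘ r a d))
    (ℚᵘ.*≡* (trans (cross a (ℤ.+ r) (ℤ.+ suc d))
                   (cong (ℤ.+ suc r ℤ.* a ℤ.*_) (sym (ℤP.pos-* (suc d) (suc d))))))
    where
    cross : ∀ a r D → (a ℤ.* D ℤ.+ (r ℤ.* a) ℤ.* D) ℤ.* D ≡ ((ℤ.+ 1 ℤ.+ r) ℤ.* a) ℤ.* (D ℤ.* D)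
    cross = solve-∀

  archimedean : ∀ y → 0ℚ < y → ∃ λ r → 1ℚ < r · y
  archimedean (ℚ.mkℚ (ℤ.+ 0) d _) (ℚ.*<* (+<+ ()))
  archimedean (ℚ.mkℚ ℤ.-[1+ a ] d _) (ℚ.*<* ())
  archimedean y@(ℚ.mkℚ (ℤ.+ suc a) d _) _ =
    r , ℚP.toℚᵘ-cancel-<
          (ℚᵘP.<-respʳ-≃ (ℚᵘP.≃-sym (ℚᵘP.≃-trans (toℚᵘ-· r y) (·ᵘ-mkℚᵘ r (ℤ.+ suc a) d))) 1<ry)
    where
    r : ℕ
    r = suc (suc d)
    1<ry : ℚ.toℚᵘ 1ℚ ℚᵘ.< mkℚᵘ (ℤ.+ r ℤ.* ℤ.+ suc a) d
    1<ry = ℚᵘ.*<* (subst₂ ℤ._<_ (sym (ℤP.*-identityˡ (ℤ.+ suc d)))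
                   (trans (ℤP.pos-* r (suc a)) (sym (ℤP.*-identityʳ _))) (+<+ (ℕP.m≤m*n r (suc a))))

  ^-nonNeg : ∀ {B} r → 0ℚ ≤ B → 0ℚ ≤ B ^ r
  ^-nonNeg zero    0≤B = ℚP.<⇒≤ 0<1
  ^-nonNeg (suc r) 0≤B = *-nonNeg 0≤B (^-nonNeg r 0≤B)

  ^-not-boundedBelow : ∀ {B ε} → 0ℚ ≤ B → B < 1ℚ → 0ℚ < ε → ¬ (∀ r → ε ≤ B ^ r)
  ^-not-boundedBelow {B} {ε} 0≤B B<1 0<ε ε≤B^ =
    let r , 1<ry = archimedean y 0<y in
    ℚP.<-irrefl refl (begin-strict
      1ℚ            <⟨ 1<ry ⟩
      r · y         ≡⟨ sym (ℚP.+-identityʳ (r · y)) ⟩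
      r · y + 0ℚ    ≤⟨ ℚP.+-monoʳ-≤ (r · y) (^-nonNeg r 0≤B) ⟩
      r · y + B ^ r ≤⟨ bound r ⟩
      1ℚ            ∎)
    where
    x y : ℚ
    x = 1ℚ ℚ.- B
    y = ε * x
    0<x : 0ℚ < x
    0<x = subst (_< x) (ℚP.+-inverseʳ B) (ℚP.+-monoˡ-< (ℚ.- B) B<1)
    x+B≡1 : x + B ≡ 1ℚ
    x+B≡1 = trans (ℚP.+-assoc 1ℚ (ℚ.- B) B) (trans (cong (1ℚ +_) (ℚP.+-inverseˡ B)) (ℚP.+-identityʳ 1ℚ))
    0<y : 0ℚ < y
    0<y = ℚP.positive⁻¹ y {{ℚP.pos*pos⇒pos ε {{ℚ.positive 0<ε}} x {{ℚ.positive 0<x}}}}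
    open ℚP.≤-Reasoning
    -- B ^ (r + 1) = B ^ r - B ^ r * x ≤ B ^ r - y, because ε ≤ B ^ r
    bound : ∀ r → r · y + B ^ r ≤ 1ℚ
    bound zero    = ℚP.≤-refl
    bound (suc r) = begin
      (y + r · y) + B * B ^ r         ≡⟨ cong (_+ B * B ^ r) (ℚP.+-comm y (r · y)) ⟩
      (r · y + y) + B * B ^ r         ≡⟨ ℚP.+-assoc (r · y) y (B * B ^ r) ⟩
      r · y + (y + B * B ^ r)         ≤⟨ ℚP.+-monoʳ-≤ (r · y) (ℚP.+-monoˡ-≤ (B * B ^ r)
                                           (ℚP.*-monoʳ-≤-nonNeg x {{ℚ.nonNegative (ℚP.<⇒≤ 0<x)}} (ε≤B^ r))) ⟩
      r · y + (B ^ r * x + B * B ^ r) ≡⟨ cong (λ z → r · y + (B ^ r * x + z)) (ℚP.*-comm B (B ^ r)) ⟩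
      r · y + (B ^ r * x + B ^ r * B) ≡⟨ cong (r · y +_) (sym (ℚP.*-distribˡ-+ (B ^ r) x B)) ⟩
      r · y + B ^ r * (x + B)         ≡⟨ cong (λ z → r · y + B ^ r * z) x+B≡1 ⟩
      r · y + B ^ r * 1ℚ              ≡⟨ cong (r · y +_) (ℚP.*-identityʳ (B ^ r)) ⟩
      r · y + B ^ r                   ≤⟨ bound r ⟩
      1ℚ                              ∎

module FiniteDistributions where
  open import Algebra.Bundles using (CommutativeMonoid)
  open import Algebra.Properties.CommutativeSemigroup (CommutativeMonoid.commutativeSemigroup ℚP.+-0-commutativeMonoid)
    using (interchange)
  open import Data.Rational using (_≤_; _<_)
  open RationalFacts

  sumℚ-cong : ∀ n {f g : Fin n → ℚ} → (∀ i → f i ≡ g i) → sumℚ n f ≡ sumℚ n g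
  sumℚ-cong zero    f≗g = refl
  sumℚ-cong (suc n) f≗g = cong₂ _+_ (f≗g zero) (sumℚ-cong n (f≗g ∘ suc))

  sumℚ-zero : ∀ n → sumℚ n (λ _ → 0ℚ) ≡ 0ℚ
  sumℚ-zero zero    = refl
  sumℚ-zero (suc n) = trans (ℚP.+-identityˡ _) (sumℚ-zero n)

  sumℚ-+ : ∀ n (f g : Fin n → ℚ) → sumℚ n (λ i → f i + g i) ≡ sumℚ n f + sumℚ n g
  sumℚ-+ zero    f g = refl
  sumℚ-+ (suc n) f g =
    trans (cong (f zero + g zero +_) (sumℚ-+ n (f ∘ suc) (g ∘ suc)))
          (interchange (f zero) (g zero) (sumℚ n (f ∘ suc)) (sumℚ n (g ∘ suc)))

  sumℚ-*ˡ : ∀ n c (f : Fin n → ℚ) → sumℚ n (λ i → c * f i) ≡ c * sumℚ n f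
  sumℚ-*ˡ zero    c f = sym (ℚP.*-zeroʳ c)
  sumℚ-*ˡ (suc n) c f = trans (cong (c * f zero +_) (sumℚ-*ˡ n c (f ∘ suc))) (sym (ℚP.*-distribˡ-+ c _ _))

  sumℚ-*ʳ : ∀ n c (f : Fin n → ℚ) → sumℚ n (λ i → f i * c) ≡ sumℚ n f * c
  sumℚ-*ʳ n c f = trans (sumℚ-cong n (λ i → ℚP.*-comm (f i) c)) (trans (sumℚ-*ˡ n c f) (ℚP.*-comm c _))

  sumℚ-comm : ∀ m n (f : Fin m → Fin n → ℚ) →
              sumℚ m (λ i → sumℚ n (f i)) ≡ sumℚ n (λ j → sumℚ m (λ i → f i j))
  sumℚ-comm zero    n f = sym (sumℚ-zero n)
  sumℚ-comm (suc m) n f =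
    trans (cong (sumℚ n (f zero) +_) (sumℚ-comm m n (f ∘ suc))) (sym (sumℚ-+ n (f zero) _))

  sumℚ-mono-≤ : ∀ n {f g : Fin n → ℚ} → (∀ i → f i ≤ g i) → sumℚ n f ≤ sumℚ n g
  sumℚ-mono-≤ zero    f≤g = ℚP.≤-refl
  sumℚ-mono-≤ (suc n) f≤g = ℚP.+-mono-≤ (f≤g zero) (sumℚ-mono-≤ n (f≤g ∘ suc))

  sumℚ-mono-< : ∀ n {f g : Fin n → ℚ} → (∀ i → f i ≤ g i) → ∀ i → f i < g i → sumℚ n f < sumℚ n g
  sumℚ-mono-< (suc n) f≤g zero    fi<gi = ℚP.+-mono-<-≤ fi<gi (sumℚ-mono-≤ n (f≤g ∘ suc))
  sumℚ-mono-< (suc n) f≤g (suc i) fi<gi = ℚP.+-mono-≤-< (f≤g zero) (sumℚ-mono-< n (f≤g ∘ suc) i fi<gi)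

  sumℚ-≢0 : ∀ n (f : Fin n → ℚ) → sumℚ n f ≢ 0ℚ → Σ[ i ∈ Fin n ] f i ≢ 0ℚ
  sumℚ-≢0 zero    f Σf≢0 = ⊥-elim (Σf≢0 refl)
  sumℚ-≢0 (suc n) f Σf≢0 with f zero ℚP.≟ 0ℚ
  ... | no f₀≢0  = zero , f₀≢0
  ... | yes f₀≡0 =
    let i , fᵢ≢0 = sumℚ-≢0 n (f ∘ suc) (λ Σ≡0 → Σf≢0 (cong₂ _+_ f₀≡0 Σ≡0)) in suc i , fᵢ≢0

  dirac-diag : ∀ {n} (i : Fin n) → dirac i i ≡ 1ℚ
  dirac-diag zero    = refl
  dirac-diag (suc i) = dirac-diag i

  dirac-≢ : ∀ {n} {i j : Fin n} → i ≢ j → dirac i j ≡ 0ℚ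
  dirac-≢ {i = zero}  {zero}  i≢j = ⊥-elim (i≢j refl)
  dirac-≢ {i = zero}  {suc j} i≢j = refl
  dirac-≢ {i = suc i} {zero}  i≢j = refl
  dirac-≢ {i = suc i} {suc j} i≢j = dirac-≢ (i≢j ∘ cong suc)

  dirac-nonNeg : ∀ {n} (i j : Fin n) → 0ℚ ≤ dirac i j
  dirac-nonNeg i j with i Fin.≟ j
  ... | yes refl = subst (0ℚ ≤_) (sym (dirac-diag i)) (ℚP.<⇒≤ 0<1)
  ... | no i≢j   = ℚP.≤-reflexive (sym (dirac-≢ i≢j))

  dirac-≢0⇒≡ : ∀ {n} {i j : Fin n} → dirac i j ≢ 0ℚ → i ≡ j
  dirac-≢0⇒≡ {i = i} {j} δ≢0 with i Fin.≟ j
  ... | yes i≡j = i≡j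
  ... | no i≢j  = ⊥-elim (δ≢0 (dirac-≢ i≢j))

  sumℚ-dirac : ∀ n (i : Fin n) → sumℚ n (dirac i) ≡ 1ℚ
  sumℚ-dirac (suc n) zero    = trans (cong (1ℚ +_) (sumℚ-zero n)) (ℚP.+-identityʳ 1ℚ)
  sumℚ-dirac (suc n) (suc i) = trans (ℚP.+-identityˡ _) (sumℚ-dirac n i)

  bitℚ : Fin 2 → ℚ
  bitℚ zero    = 0ℚ
  bitℚ (suc _) = 1ℚ

  dirac-bit : ∀ {n} (i j : Fin n) → Σ[ c ∈ Fin 2 ] dirac i j ≡ bitℚ c
  dirac-bit i j with i Fin.≟ j
  ... | yes refl = suc zero , dirac-diag i
  ... | no i≢j   = zero , dirac-≢ i≢j

  entrySize : ℚ → ℕ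
  entrySize q = ℤ.∣ ℚ.numerator q ∣ ℕ.+ ℚ.denominatorℕ q

  ¼ : ℚ
  ¼ = ½ * ½

  0<¼ : 0ℚ < ¼
  0<¼ = ℚ.*<* (+<+ (s≤s z≤n))

  uniform₄ : ∀ {n} → (Fin 2 → Fin 2 → Fin n) → Fin n → ℚ
  uniform₄ f j = ¼ * sumℚ 2 (λ c → sumℚ 2 (λ c′ → dirac (f c c′) j))

  module _ {n : ℕ} (f : Fin 2 → Fin 2 → Fin n) where

    uniform₄-nonNeg : ∀ j → 0ℚ ≤ uniform₄ f j
    uniform₄-nonNeg j = *-nonNeg (ℚP.<⇒≤ 0<¼)
      (sumℚ-mono-≤ 2 {λ _ → 0ℚ} λ c → sumℚ-mono-≤ 2 {λ _ → 0ℚ} λ c′ → dirac-nonNeg (f c c′) j)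

    uniform₄-sum : sumℚ n (uniform₄ f) ≡ 1ℚ
    uniform₄-sum = begin
      sumℚ n (λ j → ¼ * sumℚ 2 (λ c → sumℚ 2 (λ c′ → dirac (f c c′) j)))
        ≡⟨ sumℚ-*ˡ n ¼ (λ j → sumℚ 2 (λ c → sumℚ 2 (λ c′ → dirac (f c c′) j))) ⟩
      ¼ * sumℚ n (λ j → sumℚ 2 (λ c → sumℚ 2 (λ c′ → dirac (f c c′) j)))
        ≡⟨ cong (¼ *_) (sym (sumℚ-comm 2 n (λ c j → sumℚ 2 (λ c′ → dirac (f c c′) j)))) ⟩
      ¼ * sumℚ 2 (λ c → sumℚ n (λ j → sumℚ 2 (λ c′ → dirac (f c c′) j)))
        ≡⟨ cong (¼ *_) (sumℚ-cong 2 λ c → sym (sumℚ-comm 2 n (λ c′ j → dirac (f c c′) j))) ⟩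
      ¼ * sumℚ 2 (λ c → sumℚ 2 (λ c′ → sumℚ n (dirac (f c c′))))
        ≡⟨ cong (¼ *_) (sumℚ-cong 2 λ c → sumℚ-cong 2 λ c′ → sumℚ-dirac n (f c c′)) ⟩
      1ℚ ∎
      where open ≡-Reasoning

    uniform₄-pos : ∀ c c′ → 0ℚ < uniform₄ f (f c c′)
    uniform₄-pos c c′ = ℚP.*-monoʳ-<-pos ¼
      (sumℚ-mono-< 2 (λ d → sumℚ-mono-≤ 2 λ d′ → dirac-nonNeg (f d d′) (f c c′)) c
        (sumℚ-mono-< 2 (λ d′ → dirac-nonNeg (f c d′) (f c c′)) c′
          (subst (0ℚ <_) (sym (dirac-diag (f c c′))) 0<1)))

    uniform₄-support : ∀ j → uniform₄ f j ≢ 0ℚ → ∃₂ λ c c′ → f c c′ ≡ j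
    uniform₄-support j p≢0 =
      let c  , Σc≢0 = sumℚ-≢0 2 (λ c → sumℚ 2 (λ c′ → dirac (f c c′) j)) (λ Σ≡0 → p≢0 (cong (¼ *_) Σ≡0))
          c′ , d≢0  = sumℚ-≢0 2 (λ c′ → dirac (f c c′) j) Σc≢0
      in c , c′ , dirac-≢0⇒≡ d≢0

    -- the entry is k / 4 for some k ≤ 4; the sixteen cases are decided by evaluation
    uniform₄-entrySize : ∀ j → entrySize (uniform₄ f j) ℕ.≤ 7
    uniform₄-entrySize j
      with dirac-bit (f zero zero) j | dirac-bit (f zero (suc zero)) j
         | dirac-bit (f (suc zero) zero) j | dirac-bit (f (suc zero) (suc zero)) j
    ... | a , ea | b , eb | c , ec | d , ed rewrite ea | eb | ec | ed = bounded a b c d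
      where
      bounded : ∀ a b c d →
        entrySize (¼ * ((bitℚ a + (bitℚ b + 0ℚ)) + ((bitℚ c + (bitℚ d + 0ℚ)) + 0ℚ))) ℕ.≤ 7
      bounded = toWitness {a? = all? λ a → all? λ b → all? λ c → all? λ d →
        entrySize (¼ * ((bitℚ a + (bitℚ b + 0ℚ)) + ((bitℚ c + (bitℚ d + 0ℚ)) + 0ℚ))) ℕ.≤? 7} _

module SafetyValue (G : POMDP) (T : Target G) {Mem : Set}
  (upd : Mem → Fin (nO G) → Fin (nΣ G) → Mem)
  (nxt : Mem → Fin (nO G) → Fin (nΣ G) → ℚ)
  (nxt-nonNeg : ∀ μ o a → 0ℚ ℚ.≤ nxt μ o a)
  (nxt-sum : ∀ μ o → sumℚ (nΣ G) (nxt μ o) ≡ 1ℚ) where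

  open import Data.Rational using (_≤_; _<_)
  open RationalFacts
  open FiniteDistributions

  V : ℕ → Fin (nL G) → Mem → ℚ
  V = safeProb G T upd nxt

  expect : Fin (nL G) → Mem → (Fin (nΣ G) → Fin (nL G) → ℚ) → ℚ
  expect l μ h = sumℚ (nΣ G) (λ a → nxt μ (obs G l) a * sumℚ (nL G) (λ l′ → δ G l a l′ * h a l′))

  Step : Fin (nL G) → Mem → Fin (nΣ G) → Fin (nL G) → Set
  Step l μ a l′ = 0ℚ < nxt μ (obs G l) a × 0ℚ < δ G l a l′

  module _ {l : Fin (nL G)} {μ : Mem} where

    V-unsafe : ∀ {k} → T l ≡ false → V k l μ ≡ 0ℚ
    V-unsafe unsafe with T l
    ... | false = refl

    V-zero : T l ≡ true → V 0 l μ ≡ 1ℚ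
    V-zero safe with T l
    ... | true = refl

    V-suc : ∀ {k} → T l ≡ true → V (suc k) l μ ≡ expect l μ (λ a l′ → V k l′ (upd μ (obs G l) a))
    V-suc safe with T l
    ... | true = refl

    expect-mono : ∀ {h g} → (∀ a l′ → Step l μ a l′ → h a l′ ≤ g a l′) → expect l μ h ≤ expect l μ g
    expect-mono h≤g = sumℚ-mono-≤ (nΣ G) λ a →
      *-monoˡ-≤-onPos (nxt-nonNeg μ (obs G l) a) λ 0<nxt →
        sumℚ-mono-≤ (nL G) λ l′ → *-monoˡ-≤-onPos (δ-nonneg G l a l′) λ 0<δ → h≤g a l′ (0<nxt , 0<δ)

    expect-mono-< : ∀ {h g} → (∀ a l′ → Step l μ a l′ → h a l′ ≤ g a l′) →
                    ∀ a l′ → Step l μ a l′ → h a l′ < g a l′ → expect l μ h < expect l μ g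
    expect-mono-< h≤g a l′ (0<nxt , 0<δ) h<g = sumℚ-mono-< (nΣ G)
      (λ a → *-monoˡ-≤-onPos (nxt-nonNeg μ (obs G l) a) λ 0<nxt →
        sumℚ-mono-≤ (nL G) λ l′ → *-monoˡ-≤-onPos (δ-nonneg G l a l′) λ 0<δ → h≤g a l′ (0<nxt , 0<δ))
      a (ℚP.*-monoʳ-<-pos (nxt μ (obs G l) a) {{ℚ.positive 0<nxt}}
          (sumℚ-mono-< (nL G)
            (λ l′ → *-monoˡ-≤-onPos (δ-nonneg G l a l′) λ 0<δ → h≤g a l′ (0<nxt , 0<δ))
            l′ (ℚP.*-monoʳ-<-pos (δ G l a l′) {{ℚ.positive 0<δ}} h<g)))

    expect-cong : ∀ {h g} → (∀ a l′ → h a l′ ≡ g a l′) → expect l μ h ≡ expect l μ g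
    expect-cong h≗g = sumℚ-cong (nΣ G) λ a →
      cong (nxt μ (obs G l) a *_) (sumℚ-cong (nL G) λ l′ → cong (δ G l a l′ *_) (h≗g a l′))

    expect-*ʳ : ∀ h c → expect l μ (λ a l′ → h a l′ * c) ≡ expect l μ h * c
    expect-*ʳ h c = begin
      sumℚ (nΣ G) (λ a → nxt μ o a * sumℚ (nL G) (λ l′ → δ G l a l′ * (h a l′ * c)))
        ≡⟨ sumℚ-cong (nΣ G) (λ a → cong (nxt μ o a *_) (begin
             sumℚ (nL G) (λ l′ → δ G l a l′ * (h a l′ * c))
               ≡⟨ sumℚ-cong (nL G) (λ l′ → sym (ℚP.*-assoc (δ G l a l′) (h a l′) c)) ⟩
             sumℚ (nL G) (λ l′ → δ G l a l′ * h a l′ * c)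
               ≡⟨ sumℚ-*ʳ (nL G) c (λ l′ → δ G l a l′ * h a l′) ⟩
             sumℚ (nL G) (λ l′ → δ G l a l′ * h a l′) * c ∎)) ⟩
      sumℚ (nΣ G) (λ a → nxt μ o a * (sumℚ (nL G) (λ l′ → δ G l a l′ * h a l′) * c))
        ≡⟨ sumℚ-cong (nΣ G) (λ a → sym (ℚP.*-assoc (nxt μ o a) _ c)) ⟩
      sumℚ (nΣ G) (λ a → nxt μ o a * sumℚ (nL G) (λ l′ → δ G l a l′ * h a l′) * c)
        ≡⟨ sumℚ-*ʳ (nΣ G) c (λ a → nxt μ o a * sumℚ (nL G) (λ l′ → δ G l a l′ * h a l′)) ⟩
      expect l μ h * c ∎
      where
      open ≡-Reasoning
      o : Fin (nO G)
      o = obs G l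

    expect-const : ∀ c → expect l μ (λ _ _ → c) ≡ c
    expect-const c = begin
      expect l μ (λ _ _ → c)                             ≡⟨ sym (expect-cong λ _ _ → ℚP.*-identityˡ c) ⟩
      expect l μ (λ _ _ → 1ℚ * c)                        ≡⟨ expect-*ʳ (λ _ _ → 1ℚ) c ⟩
      expect l μ (λ _ _ → 1ℚ) * c                        ≡⟨ cong (_* c) expect-1 ⟩
      1ℚ * c                                             ≡⟨ ℚP.*-identityˡ c ⟩
      c                                                  ∎
      where
      open ≡-Reasoning
      δ-total : ∀ a → sumℚ (nL G) (λ l′ → δ G l a l′ * 1ℚ) ≡ 1ℚ
      δ-total a = trans (sumℚ-cong (nL G) λ l′ → ℚP.*-identityʳ _) (δ-sum G l a)
      expect-1 : expect l μ (λ _ _ → 1ℚ) ≡ 1ℚ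
      expect-1 = trans (sumℚ-cong (nΣ G) λ a →
                         trans (cong (nxt μ (obs G l) a *_) (δ-total a)) (ℚP.*-identityʳ (nxt μ (obs G l) a)))
                       (nxt-sum μ (obs G l))

  V-bounds : ∀ k l μ → 0ℚ ≤ V k l μ × V k l μ ≤ 1ℚ
  V-bounds k l μ with T l
  V-bounds k       l μ | false = ℚP.≤-refl , ℚP.<⇒≤ 0<1
  V-bounds zero    l μ | true  = ℚP.<⇒≤ 0<1 , ℚP.≤-refl
  V-bounds (suc k) l μ | true  =
      subst (_≤ expect l μ next) (expect-const 0ℚ) (expect-mono λ a l′ _ → proj₁ (V-bounds k l′ _))
    , subst (expect l μ next ≤_) (expect-const 1ℚ) (expect-mono λ a l′ _ → proj₂ (V-bounds k l′ _))
    where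
    next : Fin (nΣ G) → Fin (nL G) → ℚ
    next a l′ = V k l′ (upd μ (obs G l) a)

  V≤1 : ∀ k l μ → V k l μ ≤ 1ℚ
  V≤1 k l μ = proj₂ (V-bounds k l μ)

  unsafe⇒V≢1 : ∀ {k l μ} → T l ≡ false → V k l μ ≢ 1ℚ
  unsafe⇒V≢1 unsafe V≡1 = ℚP.1≢0 (trans (sym V≡1) (V-unsafe unsafe))

  V≡1⇒safe : ∀ {k l μ} → V k l μ ≡ 1ℚ → T l ≡ true
  V≡1⇒safe V≡1 = ¬-not (λ unsafe → unsafe⇒V≢1 unsafe V≡1)

  V≡1-step : ∀ {k l μ} a l′ → V (suc k) l μ ≡ 1ℚ → Step l μ a l′ → V k l′ (upd μ (obs G l) a) ≡ 1ℚ
  V≡1-step {k} {l} {μ} a l′ V≡1 step with V k l′ (upd μ (obs G l) a) ℚP.≟ 1ℚ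
  ... | yes V′≡1 = V′≡1
  ... | no V′≢1  = ⊥-elim (ℚP.<-irrefl V≡1 (begin-strict
    V (suc k) l μ                                           ≡⟨ V-suc (V≡1⇒safe V≡1) ⟩
    expect l μ (λ a l′ → V k l′ (upd μ (obs G l) a))        <⟨ expect-mono-< (λ a l′ _ → V≤1 k l′ _) a l′ step
                                                                 (≤∧≢⇒< (V≤1 k l′ _) V′≢1) ⟩
    expect l μ (λ _ _ → 1ℚ)                                 ≡⟨ expect-const 1ℚ ⟩
    1ℚ                                                      ∎))
    where open ℚP.≤-Reasoning

  invariant⇒V≡1 : (Inv : Fin (nL G) → Mem → Set) →
                  (∀ {l μ} → Inv l μ → T l ≡ true) →
                  (∀ {l μ} a l′ → Inv l μ → Step l μ a l′ → Inv l′ (upd μ (obs G l) a)) →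
                  ∀ k {l μ} → Inv l μ → V k l μ ≡ 1ℚ
  invariant⇒V≡1 Inv safe step zero    inv = V-zero (safe inv)
  invariant⇒V≡1 Inv safe step (suc k) {l} {μ} inv = ℚP.≤-antisym (V≤1 (suc k) l μ) (begin
    1ℚ                                                  ≡⟨ sym (expect-const 1ℚ) ⟩
    expect l μ (λ _ _ → 1ℚ)                             ≤⟨ expect-mono (λ a l′ s →
                                                             ℚP.≤-reflexive (sym (invariant⇒V≡1 Inv safe step k (step a l′ inv s)))) ⟩
    expect l μ (λ a l′ → V k l′ (upd μ (obs G l) a))    ≡⟨ sym (V-suc (safe inv)) ⟩
    V (suc k) l μ                                       ∎)
    where open ℚP.≤-Reasoning

  -- Q d l: l is d safe steps away from Q 0. If the next k steps from Q 0 are survived with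
  -- probability at most B, surviving d + k steps from Q d costs that factor B.
  V-+-≤ : ∀ k B (Q : ℕ → Fin (nL G) → Set) →
          (∀ l μ → Q 0 l → V k l μ ≤ V 0 l μ * B) →
          (∀ d l μ a l′ → Q (suc d) l → T l ≡ true → Step l μ a l′ → Q d l′) →
          ∀ d l μ → Q d l → V (d ℕ.+ k) l μ ≤ V d l μ * B
  V-+-≤ k B Q base descend zero    l μ q = base l μ q
  V-+-≤ k B Q base descend (suc d) l μ q with T l in safety
  ... | false = ℚP.≤-reflexive (sym (ℚP.*-zeroˡ B))
  ... | true = begin
    expect l μ (λ a l′ → V (d ℕ.+ k) l′ (upd μ (obs G l) a)) ≤⟨ expect-mono (λ a l′ s →
                                                                 V-+-≤ k B Q base descend d l′ _ (descend d l μ a l′ q safety s)) ⟩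
    expect l μ (λ a l′ → V d l′ (upd μ (obs G l) a) * B)    ≡⟨ expect-*ʳ _ B ⟩
    expect l μ (λ a l′ → V d l′ (upd μ (obs G l) a)) * B    ∎
    where open ℚP.≤-Reasoning

if-false : ∀ {A : Set} {b} {x y : A} → b ≡ false → (if b then x else y) ≡ y
if-false refl = refl

×-↔Fin : ∀ {A B : Set} {a b} → A ↔ Fin a → B ↔ Fin b → (A × B) ↔ Fin (a ℕ.* b)
×-↔Fin A↔a B↔b = ↔-trans (A↔a ×-↔ B↔b) (↔-sym *↔×)

funToFin-cong : ∀ {a b} {f g : Fin a → Fin b} → (∀ i → f i ≡ g i) → Fin.funToFin f ≡ Fin.funToFin g
funToFin-cong {zero}  f≗g = refl
funToFin-cong {suc a} f≗g = cong₂ Fin.combine (f≗g zero) (funToFin-cong (f≗g ∘ suc))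

finToFun-injective : ∀ {a b} {x y : Fin (b ℕ.^ a)} → (∀ i → Fin.finToFun x i ≡ Fin.finToFun y i) → x ≡ y
finToFun-injective {a} {b} {x} {y} x≗y =
  trans (sym (FinP.funToFin-finToFin {a} x)) (trans (funToFin-cong {a} {b} x≗y) (FinP.funToFin-finToFin {a} y))

pattern start  = 0F
pattern reveal = 1F
pattern recall = 2F
pattern bad    = 3F

record Secret (N : ℕ) : Set where
  constructor secret
  field
    chosen    : Fin 2
    secretPos : Fin N
    secretBit : Fin 2

record State (N : ℕ) : Set where
  constructor state
  field
    phase  : Fin 4
    pos    : Fin N
    bit    : Fin 2
    hidden : Secret N

Observation : ℕ → Set
Observation N = Fin 4 × Fin N × Fin 2

observe : ∀ {N} → State N → Observation N
observe (state t k b _) = t , k , b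

Secret↔Fin : ∀ N → Secret N ↔ Fin (2 ℕ.* (N ℕ.* 2))
Secret↔Fin N = ↔-trans
  (mk↔ₛ′ (λ (secret c j s) → c , j , s) (λ (c , j , s) → secret c j s) (λ _ → refl) (λ _ → refl))
  (×-↔Fin ↔-refl (×-↔Fin ↔-refl ↔-refl))

State↔Fin : ∀ N → State N ↔ Fin (4 ℕ.* (N ℕ.* (2 ℕ.* (2 ℕ.* (N ℕ.* 2)))))
State↔Fin N = ↔-trans
  (mk↔ₛ′ (λ (state t k b h) → t , k , b , h) (λ (t , k , b , h) → state t k b h) (λ _ → refl) (λ _ → refl))
  (×-↔Fin ↔-refl (×-↔Fin ↔-refl (×-↔Fin ↔-refl (Secret↔Fin N))))

Observation↔Fin : ∀ N → Observation N ↔ Fin (4 ℕ.* (N ℕ.* 2))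
Observation↔Fin N = ×-↔Fin ↔-refl (×-↔Fin ↔-refl ↔-refl)

module Gadget (n : ℕ) where
  open FiniteDistributions

  N : ℕ
  N = suc n

  nStates nObs : ℕ
  nStates = 4 ℕ.* (N ℕ.* (2 ℕ.* (2 ℕ.* (N ℕ.* 2))))
  nObs    = 4 ℕ.* (N ℕ.* 2)

  opaque
    encode : State N → Fin nStates
    encode = Inverse.to (State↔Fin N)

    decode : Fin nStates → State N
    decode = Inverse.from (State↔Fin N)

    decode-encode : ∀ s → decode (encode s) ≡ s
    decode-encode = Inverse.strictlyInverseʳ (State↔Fin N)

    encode-decode : ∀ l → encode (decode l) ≡ l
    encode-decode = Inverse.strictlyInverseˡ (State↔Fin N)

    encodeObs : Observation N → Fin nObs
    encodeObs = Inverse.to (Observation↔Fin N)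

    decodeObs : Fin nObs → Observation N
    decodeObs = Inverse.from (Observation↔Fin N)

    decodeObs-encodeObs : ∀ o → decodeObs (encodeObs o) ≡ o
    decodeObs-encodeObs = Inverse.strictlyInverseʳ (Observation↔Fin N)

    encodeObs-decodeObs : ∀ o → encodeObs (decodeObs o) ≡ o
    encodeObs-decodeObs = Inverse.strictlyInverseˡ (Observation↔Fin N)

  data Next (k : Fin N) : Maybe (Fin N) → Set where
    hasNext : ∀ k′ → toℕ k′ ≡ suc (toℕ k) → Next k (just k′)
    isLast  : suc (toℕ k) ≡ N → Next k nothing

  next : Fin N → Maybe (Fin N)
  next k with suc (toℕ k) ℕ.<? N
  ... | yes k+1<N = just (Fin.fromℕ< k+1<N)
  ... | no  _     = nothing

  next-view : ∀ k → Next k (next k)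
  next-view k with suc (toℕ k) ℕ.<? N
  ... | yes k+1<N = hasNext _ (FinP.toℕ-fromℕ< k+1<N)
  ... | no  k+1≮N = isLast (ℕP.≤-antisym (FinP.toℕ<n k) (ℕP.≮⇒≥ k+1≮N))

  unchosen : Secret N
  unchosen = secret 0F 0F 0F

  initial failed : State N
  initial = state start 0F 0F unchosen
  failed  = state bad   0F 0F unchosen

  choose : Fin 2 → Fin N → Fin 2 → Secret N → Secret N
  choose _  _ _ (secret 1F j s) = secret 1F j s
  choose 0F _ _ (secret 0F j s) = secret 0F j s
  choose 1F k b (secret 0F _ _) = secret 1F k b

  mistaken : Fin N → Secret N → Fin 2 → Bool
  mistaken k (secret _ j s) a = does (k Fin.≟ j) ∧ not (does (a Fin.≟ s))

  afterReveal : Maybe (Fin N) → Fin N → Fin 2 → Secret N → Fin 2 → Fin 2 → State N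
  afterReveal (just k′) k b h c f = state reveal k′ c (choose f k b h)
  afterReveal nothing   k b h c f = state recall 0F 0F (choose 1F k b h)

  afterRecall : Maybe (Fin N) → Secret N → State N
  afterRecall (just k′) h = state recall k′ 0F h
  afterRecall nothing   h = initial

  -- successor s a c f: the coin c is the next revealed bit, the coin f decides whether the
  -- current position becomes the secret one (the last position does if none has before)
  successor : State N → Fin 2 → Fin 2 → Fin 2 → State N
  successor (state start  _ _ _) a c f = state reveal 0F c unchosen
  successor (state reveal k b h) a c f = afterReveal (next k) k b h c f
  successor (state recall k _ h) a c f = if mistaken k h a then failed else afterRecall (next k) h
  successor (state bad    _ _ _) a c f = failed

  outcome : Fin nStates → Fin 2 → Fin 2 → Fin 2 → Fin nStates
  outcome l a c f = encode (successor (decode l) a c f)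

  δ′ : Fin nStates → Fin 2 → Fin nStates → ℚ
  δ′ l a = uniform₄ (outcome l a)

  obs′ : Fin nStates → Fin nObs
  obs′ = encodeObs ∘ observe ∘ decode

  obs′-surjective : ∀ o → Σ[ l ∈ Fin nStates ] obs′ l ≡ o
  obs′-surjective o =
    encode (withObservation (decodeObs o)) ,
    trans (cong (encodeObs ∘ observe) (decode-encode _)) (encodeObs-decodeObs o)
    where
    withObservation : Observation N → State N
    withObservation (t , k , b) = state t k b unchosen

  P : POMDP
  P = record
    { nL = nStates ; nΣ = 2 ; nO = nObs
    ; δ = δ′
    ; δ-nonneg = λ l a → uniform₄-nonNeg (outcome l a)
    ; δ-sum = λ l a → uniform₄-sum (outcome l a)
    ; obs = obs′ ; obs-surj = obs′-surjective ; init = encode initial }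

  isSafe : Fin 4 → Bool
  isSafe bad = false
  isSafe _   = true

  Safe : Target P
  Safe l = isSafe (State.phase (decode l))

  Safe-initial : Safe (encode initial) ≡ true
  Safe-initial = cong (isSafe ∘ State.phase) (decode-encode initial)

  Safe-failed : Safe (encode failed) ≡ false
  Safe-failed = cong (isSafe ∘ State.phase) (decode-encode failed)

module AlmostSureWinning (n : ℕ) where
  open FiniteDistributions
  open Gadget n

  Memory : Set
  Memory = Fin N → Fin 2

  remember : Memory → Observation N → Memory
  remember μ (reveal , k , b) = updateAt μ k (const b)
  remember μ (start  , _ , _) = μ
  remember μ (recall , _ , _) = μ
  remember μ (bad    , _ , _) = μ

  recite : Memory → Observation N → Fin 2
  recite μ (_ , k , _) = μ k

  strategy : PureStrategy P Memory
  strategy = record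
    { m₀ = const 0F ; upd = λ μ o _ → remember μ (decodeObs o) ; act = λ μ o → recite μ (decodeObs o) }

  Stored : Secret N → Memory → Set
  Stored (secret _ j s) μ = μ j ≡ s

  StoredBefore : Fin N → Secret N → Memory → Set
  StoredBefore k (secret 0F _ _) μ = ⊤
  StoredBefore k (secret 1F j s) μ = toℕ j ℕ.< toℕ k × μ j ≡ s

  Consistent : State N → Memory → Set
  Consistent (state start  _ _ _) μ = ⊤
  Consistent (state reveal k _ h) μ = StoredBefore k h μ
  Consistent (state recall _ _ h) μ = Stored h μ
  Consistent (state bad    _ _ _) μ = ⊥

  consistent⇒safe : ∀ s μ → Consistent s μ → isSafe (State.phase s) ≡ true
  consistent⇒safe (state start  _ _ _) μ _ = refl
  consistent⇒safe (state reveal _ _ _) μ _ = refl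
  consistent⇒safe (state recall _ _ _) μ _ = refl
  consistent⇒safe (state bad    _ _ _) μ ()

  choose-storedBefore : ∀ {k k′ b μ} h f → toℕ k′ ≡ suc (toℕ k) → StoredBefore k h μ →
                        StoredBefore k′ (choose f k b h) (updateAt μ k (const b))
  choose-storedBefore {k} {k′} {b} {μ} (secret 1F j s) f k′≡k+1 (j<k , μj≡s) =
    subst (toℕ j ℕ.<_) (sym k′≡k+1) (ℕP.m<n⇒m<1+n j<k) ,
    trans (updateAt-minimal j k μ (λ j≡k → ℕP.<-irrefl (cong toℕ j≡k) j<k)) μj≡s
  choose-storedBefore (secret 0F j s) 0F k′≡k+1 _ = tt
  choose-storedBefore {k} {μ = μ} (secret 0F j s) 1F k′≡k+1 _ =
    subst (toℕ k ℕ.<_) (sym k′≡k+1) (ℕP.n<1+n (toℕ k)) , updateAt-updates k μ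

  choose-stored : ∀ {k b μ} h → StoredBefore k h μ → Stored (choose 1F k b h) (updateAt μ k (const b))
  choose-stored {k} {μ = μ} (secret 1F j s) (j<k , μj≡s) =
    trans (updateAt-minimal j k μ (λ j≡k → ℕP.<-irrefl (cong toℕ j≡k) j<k)) μj≡s
  choose-stored {k} {μ = μ} (secret 0F j s) _ = updateAt-updates k μ

  stored⇒¬mistaken : ∀ {μ} k h → Stored h μ → mistaken k h (μ k) ≡ false
  stored⇒¬mistaken {μ} k (secret _ j s) μj≡s with k Fin.≟ j
  ... | no _     = refl
  ... | yes refl with μ k Fin.≟ s
  ...   | yes _     = refl
  ...   | no  μk≢s  = ⊥-elim (μk≢s μj≡s)

  consistent-step : ∀ s μ c f → Consistent s μ →
                    Consistent (successor s (μ (State.pos s)) c f) (remember μ (observe s))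
  consistent-step (state start  _ _ _) μ c f _ = tt
  consistent-step (state reveal k b h) μ c f inv with next k | next-view k
  ... | just k′ | hasNext _ k′≡k+1 = choose-storedBefore h f k′≡k+1 inv
  ... | nothing | isLast _          = choose-stored h inv
  consistent-step (state recall k _ h) μ c f inv =
    subst (λ s → Consistent s μ) (sym (if-false (stored⇒¬mistaken {μ} k h inv))) (afterRecall-consistent (next k))
    where
    afterRecall-consistent : ∀ k′ → Consistent (afterRecall k′ h) μ
    afterRecall-consistent (just _) = inv
    afterRecall-consistent nothing  = tt
  consistent-step (state bad    _ _ _) μ c f ()

  open PureStrategy strategy using (upd; act)
  open SafetyValue P Safe upd (λ μ o → dirac (act μ o))
                   (λ μ o → dirac-nonNeg (act μ o)) (λ μ o → sumℚ-dirac 2 (act μ o))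

  almostSure : AlmostSurePure P Safe strategy
  almostSure k = invariant⇒V≡1 Inv
    (λ {l} {μ} → consistent⇒safe (decode l) μ) preserved k
    (subst (λ s → Consistent s (const 0F)) (sym (decode-encode initial)) tt)
    where
    Inv : Fin nStates → Memory → Set
    Inv l μ = Consistent (decode l) μ
    preserved : ∀ {l μ} a l′ → Inv l μ → Step l μ a l′ → Inv l′ (remember μ (decodeObs (obs′ l)))
    preserved {l} {μ} a l′ inv (0<act , 0<δ)
      with dirac-≢0⇒≡ {i = recite μ (decodeObs (obs′ l))} {a} (ℚP.<⇒≢ 0<act ∘ sym)
         | uniform₄-support (outcome l a) l′ (ℚP.<⇒≢ 0<δ ∘ sym)
    ... | refl | c , f , refl
      rewrite decodeObs-encodeObs (observe (decode l))
            | decode-encode (successor (decode l) (μ (State.pos (decode l))) c f)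
      = consistent-step (decode l) μ c f inv

module MemoryLowerBound (n m : ℕ) (σ : Strategy (Gadget.P n) (Fin m)) where
  open import Data.Rational using (_≤_; _<_)
  open import Algebra.Definitions.RawSemiring ℚ.+-*-rawSemiring using (_^_)
  open RationalFacts
  open FiniteDistributions
  open Gadget n
  open Strategy σ
  open SafetyValue P Safe upd nxt nxt-nonneg nxt-sum

  positiveAction : ∀ μ o → Σ[ a ∈ Fin 2 ] nxt μ o a ≢ 0ℚ
  positiveAction μ o = sumℚ-≢0 2 (nxt μ o) (λ Σ≡0 → ℚP.1≢0 (trans (sym (nxt-sum μ o)) Σ≡0))

  act : Fin m → Observation N → Fin 2
  act μ o = proj₁ (positiveAction μ (encodeObs o))

  act-pos : ∀ μ o → 0ℚ < nxt μ (encodeObs o) (act μ o)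
  act-pos μ o = ≤∧≢⇒< (nxt-nonneg μ (encodeObs o) (act μ o)) (proj₂ (positiveAction μ (encodeObs o)) ∘ sym)

  follow : Fin m → Observation N → Fin m
  follow μ o = upd μ (encodeObs o) (act μ o)

  record _⟶[_]_ (s : State N) (a : Fin 2) (t : State N) : Set where
    constructor by-coins
    field
      coin₁ coin₂ : Fin 2
      reaches     : successor s a coin₁ coin₂ ≡ t

  V≡1-⟶ : ∀ {k μ} s {t} → V (suc k) (encode s) μ ≡ 1ℚ → s ⟶[ act μ (observe s) ] t →
          V k (encode t) (follow μ (observe s)) ≡ 1ℚ
  V≡1-⟶ {k} {μ} s V≡1 (by-coins c f refl) =
    subst (λ s′ → V k (encode (successor s′ (act μ (observe s′)) c f)) (follow μ (observe s′)) ≡ 1ℚ)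
      (decode-encode s)
      (V≡1-step a (outcome (encode s) a c f) V≡1
        (act-pos μ (observe (decode (encode s))) , uniform₄-pos (outcome (encode s) a) c f))
    where
    a : Fin 2
    a = act μ (observe (decode (encode s)))

  position : (i : ℕ) → .(i ℕ.< N) → Fin N
  position i i<N = Fin.fromℕ< i<N

  next-position : ∀ i .(p : i ℕ.< N) .(q : suc i ℕ.< N) → next (position i p) ≡ just (position (suc i) q)
  next-position i p q with next (position i p) | next-view (position i p)
  ... | just k′ | hasNext _ k′≡ = cong just (FinP.toℕ-injective
        (trans k′≡ (trans (cong suc (FinP.toℕ-fromℕ< p)) (sym (FinP.toℕ-fromℕ< q)))))
  ... | nothing | isLast ≡N = ⊥-elim-irr (ℕP.<-irrefl (trans (cong suc (sym (FinP.toℕ-fromℕ< p))) ≡N) q)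

  lastPosition : n ℕ.< N
  lastPosition = ℕP.n<1+n n

  next-lastPosition : next (position n lastPosition) ≡ nothing
  next-lastPosition with next (position n lastPosition) | next-view (position n lastPosition)
  ... | just k′ | hasNext _ k′≡ =
    ⊥-elim (ℕP.<-irrefl (trans k′≡ (cong suc (FinP.toℕ-fromℕ< lastPosition))) (FinP.toℕ<n k′))
  ... | nothing | isLast _ = refl

  1+i<N⇒i<N : ∀ {i} → suc i ℕ.< N → i ℕ.< N
  1+i<N⇒i<N {i} = ℕP.<-trans (ℕP.n<1+n i)

  revealObs : (Fin N → Fin 2) → (i : ℕ) → .(i ℕ.< N) → Observation N
  revealObs b i p = reveal , position i p , b (position i p)

  recallObs : (i : ℕ) → .(i ℕ.< N) → Observation N
  recallObs i p = recall , position i p , 0F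

  revealMemory : Fin m → (Fin N → Fin 2) → (i : ℕ) → .(i ℕ.< N) → Fin m
  revealMemory μ₀ b zero    _ = follow μ₀ (observe initial)
  revealMemory μ₀ b (suc i) p = follow (revealMemory μ₀ b i (1+i<N⇒i<N p)) (revealObs b i (1+i<N⇒i<N p))

  recallMemory : Fin m → (i : ℕ) → .(i ℕ.< N) → Fin m
  recallMemory ρ zero    _ = ρ
  recallMemory ρ (suc i) p = follow (recallMemory ρ i (1+i<N⇒i<N p)) (recallObs i (1+i<N⇒i<N p))

  memoryAfterReveal : Fin m → (Fin N → Fin 2) → Fin m
  memoryAfterReveal μ₀ b = follow (revealMemory μ₀ b n lastPosition) (revealObs b n lastPosition)

  roundLength : ℕ
  roundLength = suc (n ℕ.+ suc N)

  mistaken-≢ : ∀ {k c j s} a → k ≢ j → mistaken k (secret c j s) a ≡ false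
  mistaken-≢ {k} {j = j} a k≢j with k Fin.≟ j
  ... | yes k≡j = ⊥-elim (k≢j k≡j)
  ... | no  _   = refl

  mistaken-≡ : ∀ {k c s} a → a ≢ s → mistaken k (secret c k s) a ≡ true
  mistaken-≡ {k} {s = s} a a≢s with k Fin.≟ k | a Fin.≟ s
  ... | no k≢k | _       = ⊥-elim (k≢k refl)
  ... | yes _  | yes a≡s = ⊥-elim (a≢s a≡s)
  ... | yes _  | no  _   = refl

  module Round (μ₀ : Fin m) (b : Fin N → Fin 2) (j : Fin N)
               (survives : V roundLength (encode initial) μ₀ ≡ 1ℚ) where

    secretBefore : ℕ → Secret N
    secretBefore i with toℕ j ℕ.<? i
    ... | yes _ = secret 1F j (b j)
    ... | no  _ = unchosen

    revealState : (i : ℕ) → .(i ℕ.< N) → State N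
    revealState i p = state reveal (position i p) (b (position i p)) (secretBefore i)

    recallState : (i : ℕ) → .(i ℕ.< N) → State N
    recallState i p = state recall (position i p) 0F (secret 1F j (b j))

    choose-secretBefore : ∀ i .(p : i ℕ.< N) → toℕ j ℕ.≤ i →
                          choose 1F (position i p) (b (position i p)) (secretBefore i) ≡ secret 1F j (b j)
    choose-secretBefore i p j≤i with toℕ j ℕ.<? i
    ... | yes _  = refl
    ... | no j≮i rewrite FinP.toℕ-injective {i = position i p} {j}
                           (trans (FinP.toℕ-fromℕ< p) (ℕP.≤-antisym (ℕP.≮⇒≥ j≮i) j≤i)) = refl

    secretBefore-suc : ∀ i .(p : i ℕ.< N) →
                       Σ[ f ∈ Fin 2 ] choose f (position i p) (b (position i p)) (secretBefore i) ≡ secretBefore (suc i)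
    secretBefore-suc i p with toℕ j ℕ.<? suc i
    ... | yes j<1+i = 1F , choose-secretBefore i p (ℕP.≤-pred j<1+i)
    ... | no  j≮1+i with toℕ j ℕ.<? i
    ...   | yes j<i = ⊥-elim (j≮1+i (ℕP.m<n⇒m<1+n j<i))
    ...   | no  _   = 0F , refl

    reveal-⟶ : ∀ i .(p : i ℕ.< N) .(q : suc i ℕ.< N) a → revealState i p ⟶[ a ] revealState (suc i) q
    reveal-⟶ i p q a =
      let f , chosen = secretBefore-suc i p in
      by-coins (b (position (suc i) q)) f $
      trans (cong (λ k′ → afterReveal k′ (position i p) (b (position i p)) (secretBefore i)
                                        (b (position (suc i) q)) f)
                  (next-position i p q))
            (cong (state reveal (position (suc i) q) (b (position (suc i) q))) chosen)

    reveal-⟶-recall : ∀ a → revealState n lastPosition ⟶[ a ] recallState 0 (s≤s z≤n)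
    reveal-⟶-recall a = by-coins 0F 0F $
      trans (cong (λ k′ → afterReveal k′ (position n lastPosition) (b (position n lastPosition))
                                        (secretBefore n) 0F 0F)
                  next-lastPosition)
            (cong (state recall 0F 0F) (choose-secretBefore n lastPosition (ℕP.≤-pred (FinP.toℕ<n j))))

    recall-⟶ : ∀ i .(p : i ℕ.< N) .(q : suc i ℕ.< N) → suc i ℕ.≤ toℕ j → ∀ a →
               recallState i p ⟶[ a ] recallState (suc i) q
    recall-⟶ i p q i<j a = by-coins 0F 0F $
      trans (if-false (mistaken-≢ {position i p} {1F} {j} {b j} a λ i≡j →
                         ℕP.<-irrefl (trans (sym (FinP.toℕ-fromℕ< p)) (cong toℕ i≡j)) i<j))
            (cong (λ k′ → afterRecall k′ (secret 1F j (b j))) (next-position i p q))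

    revealed : ∀ i r .(p : i ℕ.< N) → i ℕ.+ r ≡ n →
               V (r ℕ.+ suc N) (encode (revealState i p)) (revealMemory μ₀ b i p) ≡ 1ℚ
    revealed zero    r p refl = V≡1-⟶ initial survives (by-coins (b 0F) 0F refl)
    revealed (suc i) r p i+r≡n =
      V≡1-⟶ (revealState i _) (revealed i (suc r) _ (trans (ℕP.+-suc i r) i+r≡n)) (reveal-⟶ i _ p _)

    recalled : ∀ i r .(p : i ℕ.< N) → i ℕ.≤ toℕ j → i ℕ.+ r ≡ n →
               V (suc r) (encode (recallState i p)) (recallMemory (memoryAfterReveal μ₀ b) i p) ≡ 1ℚ
    recalled zero    r p _   refl =
      V≡1-⟶ (revealState n lastPosition) (revealed n 0 lastPosition (ℕP.+-identityʳ n)) (reveal-⟶-recall _)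
    recalled (suc i) r p i<j i+r≡n =
      V≡1-⟶ (recallState i _) (recalled i (suc r) _ (ℕP.<⇒≤ i<j) (trans (ℕP.+-suc i r) i+r≡n))
        (recall-⟶ i _ p i<j _)

    j<N : toℕ j ℕ.< N
    j<N = FinP.toℕ<n j

    memoryAtSecret : Fin m
    memoryAtSecret = recallMemory (memoryAfterReveal μ₀ b) (toℕ j) j<N

    recites : act memoryAtSecret (recallObs (toℕ j) j<N) ≡ b j
    recites with act memoryAtSecret (recallObs (toℕ j) j<N) Fin.≟ b j
    ... | yes a≡bj = a≡bj
    ... | no  a≢bj = ⊥-elim (unsafe⇒V≢1 Safe-failed (V≡1-⟶ (recallState (toℕ j) j<N)
                       (recalled (toℕ j) (n ℕ.∸ toℕ j) j<N ℕP.≤-refl j+[n∸j]≡n) fails))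
      where
      j+[n∸j]≡n : toℕ j ℕ.+ (n ℕ.∸ toℕ j) ≡ n
      j+[n∸j]≡n = ℕP.m+[n∸m]≡n (ℕP.≤-pred j<N)
      a : Fin 2
      a = act memoryAtSecret (recallObs (toℕ j) j<N)
      fails : recallState (toℕ j) j<N ⟶[ a ] failed
      fails = by-coins 0F 0F $
        cong (λ mistake → if mistake then failed else afterRecall (next (position (toℕ j) j<N)) (secret 1F j (b j)))
          (subst (λ k → mistaken k (secret 1F j (b j)) a ≡ true) (sym (FinP.fromℕ<-toℕ j j<N))
                 (mistaken-≡ {j} {1F} {b j} a a≢bj))

  survivingRound⇒2^N≤m : ∀ μ₀ → V roundLength (encode initial) μ₀ ≡ 1ℚ → 2 ℕ.^ N ℕ.≤ m
  survivingRound⇒2^N≤m μ₀ survives = FinP.injective⇒≤ {f = memoryFor} injective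
    where
    memoryFor : Fin (2 ℕ.^ N) → Fin m
    memoryFor x = memoryAfterReveal μ₀ (Fin.finToFun x)
    recitedAt : Fin N → Fin m → Fin 2
    recitedAt j ρ = act (recallMemory ρ (toℕ j) (FinP.toℕ<n j)) (recallObs (toℕ j) (FinP.toℕ<n j))
    injective : ∀ {x y} → memoryFor x ≡ memoryFor y → x ≡ y
    injective {x} {y} ρx≡ρy = finToFun-injective {N} {2} λ j →
      trans (sym (Round.recites μ₀ (Fin.finToFun x) j survives))
        (trans (cong (recitedAt j) ρx≡ρy) (Round.recites μ₀ (Fin.finToFun y) j survives))

  -- every play from initial is back at initial or in the sink after exactly roundLength steps
  stepsLeft : State N → ℕ
  stepsLeft (state start  _ _ _) = roundLength
  stepsLeft (state reveal k _ _) = N ℕ.+ (N ℕ.∸ toℕ k)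
  stepsLeft (state recall k _ _) = N ℕ.∸ toℕ k
  stepsLeft (state bad    _ _ _) = 0

  OnSchedule : ℕ → State N → Set
  OnSchedule d s = isSafe (State.phase s) ≡ false ⊎ stepsLeft s ≡ d ⊎ (d ≡ 0 × s ≡ initial)

  N∸k≡1+N∸[1+k] : ∀ k → N ℕ.∸ toℕ k ≡ suc (N ℕ.∸ suc (toℕ k))
  N∸k≡1+N∸[1+k] k = ℕP.+-∸-assoc 1 (FinP.toℕ<n k)

  N∸next : ∀ {k k′ : Fin N} → toℕ k′ ≡ suc (toℕ k) → N ℕ.∸ toℕ k ≡ suc (N ℕ.∸ toℕ k′)
  N∸next {k} k′≡k+1 = trans (N∸k≡1+N∸[1+k] k) (cong (λ i → suc (N ℕ.∸ i)) (sym k′≡k+1))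

  N∸last : ∀ {k : Fin N} → suc (toℕ k) ≡ N → N ℕ.∸ toℕ k ≡ 1
  N∸last {k} k+1≡N = trans (N∸k≡1+N∸[1+k] k) (cong suc (trans (cong (N ℕ.∸_) k+1≡N) (ℕP.n∸n≡0 N)))

  onSchedule-successor : ∀ d s a c f → stepsLeft s ≡ suc d → OnSchedule d (successor s a c f)
  onSchedule-successor d (state start _ _ _) a c f left =
    inj₂ (inj₁ (trans (sym (ℕP.+-suc n N)) (ℕP.suc-injective left)))
  onSchedule-successor d (state reveal k b h) a c f left with next k | next-view k
  ... | just k′ | hasNext _ k′≡k+1 =
    inj₂ (inj₁ (ℕP.suc-injective
      (trans (sym (ℕP.+-suc N _)) (trans (cong (N ℕ.+_) (sym (N∸next k′≡k+1))) left))))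
  ... | nothing | isLast k+1≡N =
    inj₂ (inj₁ (ℕP.suc-injective
      (trans (ℕP.+-comm 1 N) (trans (cong (N ℕ.+_) (sym (N∸last k+1≡N))) left))))
  onSchedule-successor d (state recall k b h) a c f left with mistaken k h a
  ... | true  = inj₁ refl
  ... | false with next k | next-view k
  ...   | just k′ | hasNext _ k′≡k+1 = inj₂ (inj₁ (ℕP.suc-injective (trans (sym (N∸next k′≡k+1)) left)))
  ...   | nothing | isLast k+1≡N     = inj₂ (inj₂ (ℕP.suc-injective (trans (sym left) (N∸last k+1≡N)) , refl))
  onSchedule-successor d (state bad _ _ _) a c f ()

  stepsLeft≡0⇒unsafe : ∀ s → stepsLeft s ≡ 0 → isSafe (State.phase s) ≡ false
  stepsLeft≡0⇒unsafe (state start  _ _ _) ()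
  stepsLeft≡0⇒unsafe (state reveal _ _ _) ()
  stepsLeft≡0⇒unsafe (state recall k _ _) left = ⊥-elim (ℕP.1+n≢0 (trans (sym (N∸k≡1+N∸[1+k] k)) left))
  stepsLeft≡0⇒unsafe (state bad    _ _ _) _    = refl

  decay : ∀ {B} → 0ℚ ≤ B → (∀ μ → V roundLength (encode initial) μ ≤ B) →
          ∀ r μ → V (r ℕ.* roundLength) (encode initial) μ ≤ B ^ r
  decay 0≤B V≤B zero μ = ℚP.≤-reflexive (V-zero Safe-initial)
  decay {B} 0≤B V≤B (suc r) μ = begin
    V (roundLength ℕ.+ r ℕ.* roundLength) (encode initial) μ
      ≤⟨ V-+-≤ (r ℕ.* roundLength) (B ^ r) Q base descend roundLength (encode initial) μ
               (inj₂ (inj₁ (cong stepsLeft (decode-encode initial)))) ⟩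
    V roundLength (encode initial) μ * B ^ r
      ≤⟨ ℚP.*-monoʳ-≤-nonNeg (B ^ r) {{ℚ.nonNegative (^-nonNeg r 0≤B)}} (V≤B μ) ⟩
    B * B ^ r ∎
    where
    open ℚP.≤-Reasoning
    Q : ℕ → Fin nStates → Set
    Q d l = OnSchedule d (decode l)
    unsafe-base : ∀ {l μ} → Safe l ≡ false → V (r ℕ.* roundLength) l μ ≤ V 0 l μ * B ^ r
    unsafe-base unsafe = ℚP.≤-reflexive
      (trans (V-unsafe unsafe) (sym (trans (cong (_* B ^ r) (V-unsafe unsafe)) (ℚP.*-zeroˡ (B ^ r)))))
    base : ∀ l μ → Q 0 l → V (r ℕ.* roundLength) l μ ≤ V 0 l μ * B ^ r
    base l μ (inj₁ unsafe)       = unsafe-base unsafe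
    base l μ (inj₂ (inj₁ left))  = unsafe-base (stepsLeft≡0⇒unsafe (decode l) left)
    base l μ (inj₂ (inj₂ (_ , l≡initial))) =
      subst (λ l′ → V (r ℕ.* roundLength) l′ μ ≤ V 0 l′ μ * B ^ r)
        (trans (cong encode (sym l≡initial)) (encode-decode l)) (begin
          V (r ℕ.* roundLength) (encode initial) μ ≤⟨ decay 0≤B V≤B r μ ⟩
          B ^ r                                   ≡⟨ sym (ℚP.*-identityˡ (B ^ r)) ⟩
          1ℚ * B ^ r                              ≡⟨ cong (_* B ^ r) (sym (V-zero Safe-initial)) ⟩
          V 0 (encode initial) μ * B ^ r          ∎)
    descend : ∀ d l μ a l′ → Q (suc d) l → Safe l ≡ true → Step l μ a l′ → Q d l′
    descend d l μ a l′ (inj₁ unsafe) safe _ = ⊥-elim (not-¬ unsafe safe)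
    descend d l μ a l′ (inj₂ (inj₁ left)) _ (_ , 0<δ)
      with uniform₄-support (outcome l a) l′ (ℚP.<⇒≢ 0<δ ∘ sym)
    ... | c , f , refl rewrite decode-encode (successor (decode l) a c f) =
      onSchedule-successor d (decode l) a c f left

  lowerBound : Positive P Safe σ ⊎ AlmostSure P Safe σ → 2 ℕ.^ N ℕ.≤ m
  lowerBound winning with 2 ℕ.^ N ℕ.≤? m
  ... | yes 2^N≤m = 2^N≤m
  ... | no  2^N≰m =
    let B , 0≤B , B<1 , V≤B = commonBound<1 m (V roundLength (encode initial)) λ μ →
                                ≤∧≢⇒< (V≤1 roundLength (encode initial) μ) (2^N≰m ∘ survivingRound⇒2^N≤m μ)
        ε , 0<ε , ε≤V = positive winning
    in ⊥-elim (^-not-boundedBelow 0≤B B<1 0<ε λ r →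
                 ℚP.≤-trans (ε≤V (r ℕ.* roundLength)) (decay 0≤B V≤B r m₀))
    where
    positive : Positive P Safe σ ⊎ AlmostSure P Safe σ → Positive P Safe σ
    positive (inj₁ pos) = pos
    positive (inj₂ as)  = 1ℚ , 0<1 , λ k → ℚP.≤-reflexive (sym (as k))

sumℕ-≤ : ∀ n {f : Fin n → ℕ} B → (∀ i → f i ℕ.≤ B) → sumℕ n f ℕ.≤ n ℕ.* B
sumℕ-≤ zero    B f≤B = z≤n
sumℕ-≤ (suc n) B f≤B = ℕP.+-mono-≤ (f≤B zero) (sumℕ-≤ n B (f≤B ∘ suc))

sizePoly : Poly
sizePoly = 1 ∷ 4 ∷ 6 ∷ 4 ∷ 1 ∷ []

size-Gadget : ∀ n → size (Gadget.P n) ℕ.≤ 14378 ℕ.* eval sizePoly n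
size-Gadget n = begin
  size P
    ≤⟨ ℕP.+-monoʳ-≤ (nStates ℕ.+ 2 ℕ.+ nObs)
         (sumℕ-≤ nStates _ λ l → sumℕ-≤ 2 _ λ a → sumℕ-≤ nStates 7 λ l′ →
            uniform₄-entrySize (outcome l a) l′) ⟩
  nStates ℕ.+ 2 ℕ.+ nObs ℕ.+ nStates ℕ.* (2 ℕ.* (nStates ℕ.* 7))
    ≡⟨ expand n ⟩
  32 ℕ.* (N ℕ.* N) ℕ.+ 2 ℕ.+ 8 ℕ.* N ℕ.+ 14336 ℕ.* N⁴
    ≤⟨ ℕP.+-mono-≤ (ℕP.+-mono-≤ (ℕP.+-mono-≤ (ℕP.*-monoʳ-≤ 32 N²≤N⁴) (ℕP.*-monoʳ-≤ 2 1≤N⁴))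
                                 (ℕP.*-monoʳ-≤ 8 N≤N⁴)) ℕP.≤-refl ⟩
  32 ℕ.* N⁴ ℕ.+ 2 ℕ.* N⁴ ℕ.+ 8 ℕ.* N⁴ ℕ.+ 14336 ℕ.* N⁴
    ≡⟨ collect N⁴ ⟩
  14378 ℕ.* N⁴
    ≡⟨ cong (14378 ℕ.*_) (N⁴≡sizePoly n) ⟩
  14378 ℕ.* eval sizePoly n ∎
  where
  open FiniteDistributions using (uniform₄-entrySize)
  open Gadget n
  open ℕP.≤-Reasoning
  N⁴ : ℕ
  N⁴ = (N ℕ.* N) ℕ.* (N ℕ.* N)
  N²≤N⁴ : N ℕ.* N ℕ.≤ N⁴
  N²≤N⁴ = ℕP.m≤m*n (N ℕ.* N) (N ℕ.* N)
  N≤N⁴ : N ℕ.≤ N⁴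
  N≤N⁴ = ℕP.≤-trans (ℕP.m≤m*n N N) N²≤N⁴
  1≤N⁴ : 1 ℕ.≤ N⁴
  1≤N⁴ = ℕP.≤-trans (s≤s z≤n) N≤N⁴
  expand : ∀ n → let N = suc n ; S = 4 ℕ.* (N ℕ.* (2 ℕ.* (2 ℕ.* (N ℕ.* 2)))) in
           S ℕ.+ 2 ℕ.+ 4 ℕ.* (N ℕ.* 2) ℕ.+ S ℕ.* (2 ℕ.* (S ℕ.* 7))
             ≡ 32 ℕ.* (N ℕ.* N) ℕ.+ 2 ℕ.+ 8 ℕ.* N ℕ.+ 14336 ℕ.* ((N ℕ.* N) ℕ.* (N ℕ.* N))
  expand = ℕSolver.solve-∀
  collect : ∀ y → 32 ℕ.* y ℕ.+ 2 ℕ.* y ℕ.+ 8 ℕ.* y ℕ.+ 14336 ℕ.* y ≡ 14378 ℕ.* y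
  collect = ℕSolver.solve-∀
  N⁴≡sizePoly : ∀ n → (suc n ℕ.* suc n) ℕ.* (suc n ℕ.* suc n) ≡
                      1 ℕ.+ n ℕ.* (4 ℕ.+ n ℕ.* (6 ℕ.+ n ℕ.* (4 ℕ.+ n ℕ.* (1 ℕ.+ n ℕ.* 0))))
  N⁴≡sizePoly = ℕSolver.solve-∀

open import Data.Nat using (_≤_; _^_)
open import Data.List.Relation.Unary.Any using (here)

lemma3 : Σ[ p ∈ Poly ] Σ[ P ∈ (ℕ → POMDP) ] Σ[ T ∈ ((n : ℕ) → Target (P n)) ]
           ( BigO (λ n → size (P n)) p
           × (∀ n → Σ[ Mem ∈ Set ] Σ[ σ ∈ PureStrategy (P n) Mem ] AlmostSurePure (P n) (T n) σ)
           × (Σ[ q ∈ Poly ] (NonConstant q ×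
                (∀ n (m : ℕ) (σ : Strategy (P n) (Fin m)) →
                   Positive (P n) (T n) σ ⊎ AlmostSure (P n) (T n) σ →
                   2 ^ eval q n ≤ m))) )
lemma3 =
  sizePoly , Gadget.P , Gadget.Safe ,
  (14378 , 0 , λ n _ → size-Gadget n) ,
  (λ n → AlmostSureWinning.Memory n , AlmostSureWinning.strategy n , AlmostSureWinning.almostSure n) ,
  (1 ∷ 1 ∷ [] , here (s≤s z≤n) ,
   λ n m σ winning → subst (λ e → 2 ^ e ≤ m) (sym (eval-1+x n)) (MemoryLowerBound.lowerBound n m σ winning))
  where
  eval-1+x : ∀ n → eval (1 ∷ 1 ∷ []) n ≡ suc n
  eval-1+x n = cong suc (trans (cong (n ℕ.*_) (cong suc (ℕP.*-zeroʳ n))) (ℕP.*-identityʳ n))
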